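{- Consider a clause-database state with parameter $n$ (as in the context) satisfying all four invariants (Input-equivalence, Correctness, Representation, Closure). Let $\gamma\in D_i$ for some $i\in\{1,\ldots,n,\infty\}$, and let $j\in\{0,1,\ldots,n\}$ with $j<i$. Let the new state be obtained by removing $\gamma$ from $D_i$ and adding it to $D_j$, leaving all other groups unchanged. Then the new state (with the same parameter $n$) also satisfies all four invariants.
   Context: A clause is a finite set of pairwise distinct literals (read as their disjunction); a finite set of clauses is read as their conjunction (the empty set is true). Fix a CNF formula $I$ (the input clauses) and a trail $\tau=\langle \ell_1@d_1,\ldots,\ell_k@d_k\rangle$: a finite sequence of literals over pairwise distinct variables, each annotated with a decision level $d_j\in\mathbb{N}$, with $d_1\le\cdots\le d_k$ (and such that every literal that is not the first literal of its positive level is implied by $I$ together with the earlier first-literals-of-levels). For $d\in\mathbb{N}$, $\tau^{\le d}$ is the subsequence of literals with level $\le d$, viewed as a partial assignment. For a formula $\varphi$, $\tau^{\le d}\models\varphi$ means every total assignment extending $\tau^{\le d}$ satisfies $\varphi$. Write $\varphi\to^d\psi$ if $\tau^{\le d}\models(\varphi\to\psi)$ and $\varphi\leftrightarrow^d\psi$ if $\tau^{\le d}\models(\varphi\leftrightarrow\psi)$. A clause-database state with parameter $n$ consists of pairwise disjoint finite sets of clauses: active groups $D_0,D_1,\ldots,D_n,D_\infty$ and stashed groups $S_k^q$ for $1\le k\le n$, $0\le q<k$. Notation: $S_k=\bigcup_{q<k}S_k^q$; $S=\bigcup_{k=1}^n S_k$; $S^i=\bigcup_{k} S_k^i$; $P=D_0\cup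 S^0$; $D=D_1\cup\cdots\cup D_n$; $N=D_0\cup D$; $A=N\cup D_\infty$. Invariants: (Input-equivalence) $I\leftrightarrow^0 P$. (Correctness) $N\leftrightarrow^n P$. (Representation) for every $i$ with $1\le i\le n$ and every $\alpha\in S_i$, at least one of: (a) there are $r$ with $0\le r\le i$ and $\beta\in D_r$ with $\beta\to^i\alpha$; (b) there are $r\le i$, $j$ with $i<j\le n$, and $\beta\in S_j^r$ with $\beta\to^i\alpha$; (c) $\tau^{\le i}\models\alpha$. (Closure) for every $\gamma\in A\cup S$, $P\to^0\gamma$. -}

module Defs where

open import Data.Nat using (ℕ; zero; suc; _≤_; _<_)
open import Data.Nat.Properties using () renaming (_≟_ to _≟ℕ_)
open import Data.Bool using (Bool)
open import Data.Bool.Properties using () renaming (_≟_ to _≟B_)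
open import Data.Fin using (Fin; toℕ) renaming (zero to fzero)
open import Data.Fin.Properties using () renaming (_≟_ to _≟F_)
open import Data.Product using (Σ; Σ-syntax; _×_; _,_; proj₁; proj₂)
import Data.Product.Properties as ×P
open import Data.Sum using (_⊎_)
open import Data.Unit using (⊤)
open import Data.Empty using (⊥)
open import Data.List using (List; []; _∷_; _++_; filter)
import Data.List.Properties as LP
open import Data.List.Membership.Propositional using (_∈_)
open import Data.List.Relation.Unary.Any using (Any)
open import Data.List.Relation.Unary.All using (All)
open import Data.List.Relation.Unary.AllPairs using (AllPairs)
open import Relation.Nullary using (¬_; Dec; yes; no; does; ¬?)

open import Relation.Binary.PropositionalEquality using (_≡_; _≢_)
open import Relation.Binary.Definitions using (DecidableEquality)
open import Data.Bool using (if_then_else_)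

Var : Set
Var = ℕ

Literal : Set
Literal = Var × Bool

var : Literal → Var
var = proj₁

Clause : Set
Clause = List Literal

CNF : Set
CNF = List Clause

_≟L_ : DecidableEquality Literal
_≟L_ = ×P.≡-dec _≟ℕ_ _≟B_

_≟C_ : DecidableEquality Clause
_≟C_ = LP.≡-dec _≟L_

Assignment : Set
Assignment = Var → Bool

LitSat : Assignment → Literal → Set
LitSat α (v , b) = α v ≡ b

ClauseSat : Assignment → Clause → Set
ClauseSat α c = Any (LitSat α) c

CNFSat : Assignment → CNF → Set
CNFSat α F = All (ClauseSat α) F

ClauseSet : Set₁
ClauseSet = Clause → Set

SetSat : Assignment → ClauseSet → Set
SetSat α X = ∀ c → X c → ClauseSat α c

_⇔_ : Set → Set → Set
A ⇔ B = (A → B) × (B → A)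

-- A trail: sequence of literals annotated with decision levels.
Trail : Set
Trail = List (Literal × ℕ)

IsDecision : Trail → Literal × ℕ → Set
IsDecision pre (ℓ , d) = (0 < d) × All (λ y → proj₂ y ≢ d) pre

record IsTrail (I : CNF) (τ : Trail) : Set where
  field
    distinctVars : AllPairs (λ x y → var (proj₁ x) ≢ var (proj₁ y)) τ
    sortedLevels : AllPairs (λ x y → proj₂ x ≤ proj₂ y) τ
    implied      : ∀ pre ℓ d post → τ ≡ pre ++ ((ℓ , d) ∷ post) →
                   ¬ IsDecision pre (ℓ , d) →
                   ∀ (α : Assignment) → CNFSat α I →
                   (∀ pre′ x post′ → pre ≡ pre′ ++ (x ∷ post′) →
                      IsDecision pre′ x → LitSat α (proj₁ x)) →
                   LitSat α ℓ

Extends : Trail → ℕ → Assignment → Set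
Extends τ d α = ∀ ℓ e → (ℓ , e) ∈ τ → e ≤ d → LitSat α ℓ

Models : Trail → ℕ → (Assignment → Set) → Set
Models τ d φ = ∀ α → Extends τ d α → φ α

Implies : Trail → ℕ → Clause → Clause → Set
Implies τ d β γ = Models τ d (λ α → ClauseSat α β → ClauseSat α γ)

data DIdx (n : ℕ) : Set where
  fin : Fin (suc n) → DIdx n
  ∞   : DIdx n

-- All groups: D-groups and stashed groups S_k^q with k : 1..n, q < k.
-- (Sg k q with k : Fin (suc n) and q : Fin (toℕ k); for toℕ k = 0 there is no q.)
data Group (n : ℕ) : Set where
  Dg : DIdx n → Group n
  Sg : (k : Fin (suc n)) → Fin (toℕ k) → Group n

State : ℕ → Set
State n = Group n → List Clause

IsState : ∀ {n} → State n → Set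
IsState {n} st = ∀ (g h : Group n) → g ≢ h → ∀ c → c ∈ st g → c ∈ st h → ⊥

module _ {n : ℕ} (st : State n) where

  inD : Fin (suc n) → ClauseSet
  inD r c = c ∈ st (Dg (fin r))

  inSkq : (k : Fin (suc n)) → Fin (toℕ k) → ClauseSet
  inSkq k q c = c ∈ st (Sg k q)

  inSk : Fin (suc n) → ClauseSet
  inSk k c = Σ[ q ∈ Fin (toℕ k) ] inSkq k q c

  inS : ClauseSet
  inS c = Σ[ k ∈ Fin (suc n) ] inSk k c

  inS0 : ClauseSet
  inS0 c = Σ[ k ∈ Fin (suc n) ] Σ[ q ∈ Fin (toℕ k) ] (toℕ q ≡ 0 × inSkq k q c)

  inP : ClauseSet
  inP c = inD fzero c ⊎ inS0 c

  inN : ClauseSet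
  inN c = Σ[ r ∈ Fin (suc n) ] inD r c

  inA : ClauseSet
  inA c = inN c ⊎ c ∈ st (Dg ∞)

record Invariants (I : CNF) (τ : Trail) {n : ℕ} (st : State n) : Set where
  field
    input-equivalence : Models τ 0 (λ α → CNFSat α I ⇔ SetSat α (inP st))
    correctness       : Models τ n (λ α → SetSat α (inN st) ⇔ SetSat α (inP st))
    representation    :
      ∀ (i : Fin (suc n)) → 1 ≤ toℕ i → ∀ α → inSk st i α →
        (Σ[ r ∈ Fin (suc n) ] (toℕ r ≤ toℕ i ×
            Σ[ β ∈ Clause ] (inD st r β × Implies τ (toℕ i) β α)))
        ⊎ (Σ[ j ∈ Fin (suc n) ] (toℕ i < toℕ j × Σ[ r ∈ Fin (toℕ j) ] (toℕ r ≤ toℕ i ×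
            Σ[ β ∈ Clause ] (inSkq st j r β × Implies τ (toℕ i) β α))))
        ⊎ Models τ (toℕ i) (λ a → ClauseSat a α)
    closure           : ∀ γ → inA st γ ⊎ inS st γ →
                        Models τ 0 (λ α → SetSat α (inP st) → ClauseSat α γ)

_<D_ : ∀ {n} → Fin (suc n) → DIdx n → Set
j <D fin r = toℕ j < toℕ r
j <D ∞     = ⊤

_≟D_ : ∀ {n} → DecidableEquality (DIdx n)
fin r ≟D fin s with r ≟F s
... | yes Relation.Binary.PropositionalEquality.refl = yes Relation.Binary.PropositionalEquality.refl
... | no r≢s = no λ { Relation.Binary.PropositionalEquality.refl → r≢s Relation.Binary.PropositionalEquality.refl }
fin r ≟D ∞ = no λ ()
∞ ≟D fin s = no λ ()
∞ ≟D ∞ = yes Relation.Binary.PropositionalEquality.refl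

move : ∀ {n} → State n → Clause → DIdx n → Fin (suc n) → State n
move st γ i j (Dg d) =
  if does (d ≟D fin j) then γ ∷ st (Dg d)
  else if does (d ≟D i) then filter (λ c → ¬? (c ≟C γ)) (st (Dg d))
  else st (Dg d)
move st γ i j (Sg k q) = st (Sg k q)

{-# OPTIONS --safe #-}
module Submission where

-- The move turns P into P or P ∪ {γ} (γ leaves D_i only for i > 0) and N into N ∪ {γ}.
-- Since γ ∈ A, Closure gives P →^0 γ, and with Correctness also N →^n γ; so adjoining γ
-- changes neither P at level 0 nor N at level n, which yields Input-equivalence and
-- Correctness. The only new member of A ∪ S is γ, which P already implies, giving Closure.
-- A Representation witness β ∈ D_r with r ≤ k that was moved is γ with r = i, and it now
-- lies in D_j with j < i ≤ k, so it is still a witness.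

open import Defs
open import Data.Nat using (ℕ)
open import Data.Nat using (suc)
open import Data.Fin using (Fin)
open import Data.Product using (_×_)
open import Data.List.Membership.Propositional using (_∈_)

open import Data.Nat using (_≤_; z≤n)
open import Data.Nat.Properties using (≤-refl; ≤-trans; <-irrefl; <⇒≤; <-≤-trans)
open import Data.Fin using (toℕ) renaming (zero to fzero)
open import Data.Product using (Σ-syntax; _,_; proj₁; proj₂)
open import Data.Sum using (_⊎_; inj₁; inj₂; map₁)
open import Data.Empty using (⊥-elim)
open import Data.List.Relation.Unary.Any using (here; there)
open import Data.List.Membership.Propositional using (_∉_)
open import Data.List.Membership.Propositional.Properties using (∈-filter⁺; ∈-filter⁻)
open import Relation.Nullary using (yes; no; ¬?)
open import Relation.Binary.PropositionalEquality using (_≡_; _≢_; refl)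

_⊆_ : ClauseSet → ClauseSet → Set
X ⊆ Y = ∀ c → X c → Y c

infix 4 _⊆_
infixl 6 _∪｛_｝ _∪_

_∪｛_｝ : ClauseSet → Clause → ClauseSet
(X ∪｛ γ ｝) c = X c ⊎ c ≡ γ

_∪_ : ClauseSet → ClauseSet → ClauseSet
(X ∪ Y) c = X c ⊎ Y c

SetSat-⊆ : ∀ {α X Y} → X ⊆ Y → SetSat α Y → SetSat α X
SetSat-⊆ X⊆Y sat c c∈X = sat c (X⊆Y c c∈X)

SetSat-∪｛｝ : ∀ {α X γ} → SetSat α X → ClauseSat α γ → SetSat α (X ∪｛ γ ｝)
SetSat-∪｛｝ sat _     c (inj₁ c∈X) = sat c c∈X
SetSat-∪｛｝ _   sat-γ _ (inj₂ refl) = sat-γ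

SetSat-⇔-adjoin : ∀ {α X Y γ} → X ⊆ Y → Y ⊆ X ∪｛ γ ｝ →
                  (SetSat α X → ClauseSat α γ) → SetSat α X ⇔ SetSat α Y
SetSat-⇔-adjoin X⊆Y Y⊆X+γ X⇒γ =
  (λ sat → SetSat-⊆ Y⊆X+γ (SetSat-∪｛｝ sat (X⇒γ sat))) , SetSat-⊆ X⊆Y

⇔-sym : ∀ {A B} → A ⇔ B → B ⇔ A
⇔-sym (f , g) = g , f

⇔-trans : ∀ {A B C} → A ⇔ B → B ⇔ C → A ⇔ C
⇔-trans (f , g) (f′ , g′) = (λ a → f′ (f a)) , (λ c → g (g′ c))

Extends-≤ : ∀ {τ d e α} → e ≤ d → Extends τ d α → Extends τ e α
Extends-≤ e≤d ext ℓ k ℓ∈τ k≤e = ext ℓ k ℓ∈τ (≤-trans k≤e e≤d)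

Models-≤ : ∀ {τ d e φ} → e ≤ d → Models τ e φ → Models τ d φ
Models-≤ e≤d ⊨φ α ext = ⊨φ α (Extends-≤ e≤d ext)

module _ {n : ℕ} (st : State n) (γ : Clause) (i : DIdx n) (j : Fin (suc n)) where

  private
    st′ : State n
    st′ = move st γ i j

  ∈-move⁺ : ∀ g {c} → c ∈ st g → c ∈ st′ g ⊎ (c ≡ γ × g ≡ Dg i)
  ∈-move⁺ (Sg k q) c∈g = inj₁ c∈g
  ∈-move⁺ (Dg d) {c} c∈d with d ≟D fin j
  ... | yes _ = inj₁ (there c∈d)
  ... | no _ with d ≟D i
  ...   | no _ = inj₁ c∈d
  ...   | yes refl with c ≟C γ
  ...     | yes c≡γ = inj₂ (c≡γ , refl)
  ...     | no c≢γ  = inj₁ (∈-filter⁺ (λ c → ¬? (c ≟C γ)) c∈d c≢γ)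

  ∈-move⁻ : ∀ g {c} → c ∈ st′ g → c ∈ st g ⊎ (c ≡ γ × g ≡ Dg (fin j))
  ∈-move⁻ (Sg k q) c∈g = inj₁ c∈g
  ∈-move⁻ (Dg d) c∈d with d ≟D fin j
  ... | yes refl with c∈d
  ...   | here c≡γ   = inj₂ (c≡γ , refl)
  ...   | there c∈d′ = inj₁ c∈d′
  ∈-move⁻ (Dg d) c∈d | no _ with d ≟D i
  ...   | no _  = inj₁ c∈d
  ...   | yes _ = inj₁ (proj₁ (∈-filter⁻ (λ c → ¬? (c ≟C γ)) c∈d))

  γ∈move-target : γ ∈ st′ (Dg (fin j))
  γ∈move-target with fin j ≟D fin j
  ... | yes _    = here refl
  ... | no j≢j = ⊥-elim (j≢j refl)

  γ∉move-source : i ≢ fin j → γ ∉ st′ (Dg i)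
  γ∉move-source i≢j γ∈i with i ≟D fin j
  ... | yes i≡j = i≢j i≡j
  ... | no _ with i ≟D i
  ...   | yes _ = proj₂ (∈-filter⁻ (λ c → ¬? (c ≟C γ)) {xs = st (Dg i)} γ∈i) refl
  ...   | no i≢i = i≢i refl

  move-isState : IsState st → γ ∈ st (Dg i) → i ≢ fin j → IsState st′
  move-isState disjoint γ∈i i≢j g h g≢h c c∈g c∈h
    with ∈-move⁻ g c∈g | ∈-move⁻ h c∈h
  ... | inj₁ c∈g′ | inj₁ c∈h′ = disjoint g h g≢h c c∈g′ c∈h′
  ... | inj₁ c∈g′ | inj₂ (refl , refl) =
        disjoint g (Dg i) (λ { refl → γ∉move-source i≢j c∈g }) γ c∈g′ γ∈i
  ... | inj₂ (refl , refl) | inj₁ c∈h′ =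
        disjoint h (Dg i) (λ { refl → γ∉move-source i≢j c∈h }) γ c∈h′ γ∈i
  ... | inj₂ (refl , refl) | inj₂ (_ , refl) = g≢h refl

  inP-move⁺ : i ≢ fin fzero → inP st ⊆ inP st′
  inP-move⁺ i≢0 c (inj₁ c∈D₀) with ∈-move⁺ (Dg (fin fzero)) c∈D₀
  ... | inj₁ c∈D₀′ = inj₁ c∈D₀′
  ... | inj₂ (_ , refl) = ⊥-elim (i≢0 refl)
  inP-move⁺ _ c (inj₂ c∈S⁰) = inj₂ c∈S⁰

  inP-move⁻ : inP st′ ⊆ inP st ∪｛ γ ｝
  inP-move⁻ c (inj₁ c∈D₀) with ∈-move⁻ (Dg (fin fzero)) c∈D₀
  ... | inj₁ c∈D₀′ = inj₁ (inj₁ c∈D₀′)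
  ... | inj₂ (c≡γ , _) = inj₂ c≡γ
  inP-move⁻ c (inj₂ c∈S⁰) = inj₁ (inj₂ c∈S⁰)

  inN-move⁺ : inN st ⊆ inN st′
  inN-move⁺ c (r , c∈D) with ∈-move⁺ (Dg (fin r)) c∈D
  ... | inj₁ c∈D′ = r , c∈D′
  ... | inj₂ (refl , _) = j , γ∈move-target

  inN-move⁻ : inN st′ ⊆ inN st ∪｛ γ ｝
  inN-move⁻ c (r , c∈D) with ∈-move⁻ (Dg (fin r)) c∈D
  ... | inj₁ c∈D′ = inj₁ (r , c∈D′)
  ... | inj₂ (c≡γ , _) = inj₂ c≡γ

  inA-move⁻ : inA st′ ⊆ inA st ∪｛ γ ｝
  inA-move⁻ c (inj₁ c∈N) with inN-move⁻ c c∈N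
  ... | inj₁ c∈N′ = inj₁ (inj₁ c∈N′)
  ... | inj₂ c≡γ = inj₂ c≡γ
  inA-move⁻ c (inj₂ c∈D∞) with ∈-move⁻ (Dg ∞) c∈D∞
  ... | inj₁ c∈D∞′ = inj₁ (inj₂ c∈D∞′)
  ... | inj₂ (c≡γ , _) = inj₂ c≡γ

  inA∪inS-move⁻ : inA st′ ∪ inS st′ ⊆ inA st ∪ inS st ∪｛ γ ｝
  inA∪inS-move⁻ c (inj₁ c∈A) with inA-move⁻ c c∈A
  ... | inj₁ c∈A₀ = inj₁ (inj₁ c∈A₀)
  ... | inj₂ c≡γ  = inj₂ c≡γ
  inA∪inS-move⁻ c (inj₂ c∈S) = inj₁ (inj₂ c∈S)

∈D⇒inA : ∀ {n} (st : State n) d {γ} → γ ∈ st (Dg d) → inA st γ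
∈D⇒inA st (fin r) γ∈D = inj₁ (r , γ∈D)
∈D⇒inA st ∞       γ∈D = inj₂ γ∈D

<D⇒≢fin : ∀ {n} {j k : Fin (suc n)} {i : DIdx n} → toℕ k ≤ toℕ j → j <D i → i ≢ fin k
<D⇒≢fin k≤j j<i refl = <-irrefl refl (<-≤-trans j<i k≤j)

DWitness : ∀ {n} → Trail → State n → Fin (suc n) → Clause → Set
DWitness {n} τ st k α =
  Σ[ r ∈ Fin (suc n) ] (toℕ r ≤ toℕ k × Σ[ β ∈ Clause ] (inD st r β × Implies τ (toℕ k) β α))

module _ {I : CNF} {τ : Trail} {n : ℕ} {st : State n} (inv : Invariants I τ st)
         {γ : Clause} {i : DIdx n} {j : Fin (suc n)} (j<i : j <D i) (γ∈i : γ ∈ st (Dg i))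
         where

  open Invariants inv

  private
    st′ : State n
    st′ = move st γ i j

  P⇒γ : Models τ 0 (λ α → SetSat α (inP st) → ClauseSat α γ)
  P⇒γ = closure γ (inj₁ (∈D⇒inA st i γ∈i))

  P⇔P′ : Models τ 0 (λ α → SetSat α (inP st) ⇔ SetSat α (inP st′))
  P⇔P′ α ext = SetSat-⇔-adjoin (inP-move⁺ st γ i j (<D⇒≢fin z≤n j<i))
                               (inP-move⁻ st γ i j) (P⇒γ α ext)

  N⇔N′ : Models τ n (λ α → SetSat α (inN st) ⇔ SetSat α (inN st′))
  N⇔N′ α ext = SetSat-⇔-adjoin (inN-move⁺ st γ i j) (inN-move⁻ st γ i j)
    (λ sat-N → Models-≤ z≤n P⇒γ α ext (proj₁ (correctness α ext) sat-N))

  DWitness-move : ∀ {k α} → DWitness τ st k α → DWitness τ st′ k α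
  DWitness-move (r , r≤k , β , β∈D , β⇒α) with ∈-move⁺ st γ i j (Dg (fin r)) β∈D
  ... | inj₁ β∈D′ = r , r≤k , β , β∈D′ , β⇒α
  ... | inj₂ (refl , refl) = j , <⇒≤ (<-≤-trans j<i r≤k) , γ , γ∈move-target st γ i j , β⇒α

  move-invariants : Invariants I τ st′
  move-invariants = record
    { input-equivalence = λ α ext → ⇔-trans (input-equivalence α ext) (P⇔P′ α ext)
    ; correctness = λ α ext →
        ⇔-trans (⇔-sym (N⇔N′ α ext))
          (⇔-trans (correctness α ext) (Models-≤ z≤n P⇔P′ α ext))
    ; representation = λ k 1≤k α α∈S → map₁ DWitness-move (representation k 1≤k α α∈S)
    ; closure = closure′
    }
    where
      closure′ : ∀ c → (inA st′ ∪ inS st′) c →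
                 Models τ 0 (λ α → SetSat α (inP st′) → ClauseSat α c)
      closure′ c c∈A∪S′ α ext sat-P′ =
        P⇒old (inA∪inS-move⁻ st γ i j c c∈A∪S′) α ext (proj₂ (P⇔P′ α ext) sat-P′)
        where
          P⇒old : ∀ {c} → (inA st ∪ inS st ∪｛ γ ｝) c →
               Models τ 0 (λ α → SetSat α (inP st) → ClauseSat α c)
          P⇒old (inj₁ c∈A∪S) = closure _ c∈A∪S
          P⇒old (inj₂ refl)   = P⇒γ

lemma2 : (I : CNF) (τ : Trail) → IsTrail I τ →
         (n : ℕ) (st : State n) → IsState st → Invariants I τ st →
         (γ : Clause) (i : DIdx n) (j : Fin (suc n)) → j <D i → γ ∈ st (Dg i) →
         IsState (move st γ i j) × Invariants I τ (move st γ i j)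
lemma2 I τ _ n st disjoint inv γ i j j<i γ∈i =
  move-isState st γ i j disjoint γ∈i (<D⇒≢fin ≤-refl j<i) , move-invariants inv j<i γ∈i
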